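{- Let $m \ge 1$ and let $a_1 \le a_2 \le \dots \le a_{3m}$ and $B$ be positive integers with $\sum_{i=1}^{3m} a_i = mB$, $B/4 < a_i < B/2$ and $a_i \ge 8m$ for all $i$. Set $k = 3B$ and, for $i \in \{1,\dots,a_{3m}\}$, $\gamma_i = |\{ j \in \{1,\dots,3m\} : a_j \ge i\}|$. Let $G$ be the graph with vertex set $X \cup Y \cup Z$, where $X = \{x_1,\dots,x_{3m}\}$, $Y=\{y_1,\dots,y_{a_{3m}}\}$, $Z = \{z_1,\dots,z_{k - a_{3m}+1}\}$ are pairwise disjoint, and whose edges are exactly: all pairs within $X$, within $Y$, and within $Z$ (each is a clique); $\{x_i,y_j\}$ for $i \in [3m]$ and $j \le a_i$; $\{y_i,z_j\}$ for $i \in [m]$ and $j \le |Z| - B - 12m + 15$; and $\{y_i,z_j\}$ for $i \in [m+1, a_{3m}]$ and $j \le |Z| - \gamma_i$. Then $G$ is a proper interval graph of linear clique-width at most $4$.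
   Context: $[n]=\{1,\dots,n\}$ and $[m,n]=\{d\in\mathbb{Z}: m\le d\le n\}$. A graph is a proper interval graph if it is the intersection graph of a family of closed intervals on the line in which no interval properly contains another. Linear clique-width is the standard graph width parameter. -}

module Defs where

open import Level using (0ℓ)
open import Data.Nat using (ℕ; zero; suc; _+_; _*_; _∸_; _≤_; _<_; _≤?_)
open import Data.Fin using (Fin; toℕ)
import Data.Fin as Fin
open import Data.Sum using (_⊎_; inj₁; inj₂)
open import Data.Sum.Properties using (≡-dec)
open import Data.Product using (_×_; _,_; proj₁; proj₂; ∃)
open import Data.List using (List; []; _∷_; length; filter; map; upTo; foldl)
open import Data.Bool using (Bool; true; false; if_then_else_; _∨_; _∧_)
open import Data.Maybe using (Maybe; just; nothing)
import Data.Maybe as Maybe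
open import Data.Empty using (⊥)
open import Data.Rational using (ℚ) renaming (_≤_ to _≤ℚ_)
open import Relation.Binary.PropositionalEquality using (_≡_; _≢_)
open import Relation.Binary.Definitions using (DecidableEquality)
open import Relation.Nullary using (¬_; does)
open import Function.Bundles using (_⇔_)

-- Generic graph notions.  A graph is given by a vertex type V and an
-- (intended symmetric, irreflexive) adjacency relation Adj.

Interval : Set
Interval = ℚ × ℚ

Intersect : Interval → Interval → Set
Intersect (l₁ , r₁) (l₂ , r₂) = (l₁ ≤ℚ r₂) × (l₂ ≤ℚ r₁)

ProperlyContains : Interval → Interval → Set
ProperlyContains (l₁ , r₁) (l₂ , r₂) =
  (l₁ ≤ℚ l₂) × (r₂ ≤ℚ r₁) × ¬ ((l₁ ≡ l₂) × (r₁ ≡ r₂))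

IsProperIntervalGraph : (V : Set) → (V → V → Set) → Set
IsProperIntervalGraph V Adj = ∃ λ (I : V → Interval) →
  (∀ v → proj₁ (I v) ≤ℚ proj₂ (I v)) ×
  (∀ u v → u ≢ v → (Adj u v ⇔ Intersect (I u) (I v))) ×
  (∀ u v → ¬ ProperlyContains (I u) (I v))

-- Operations (applied left to right):
--   intro v i    : add the new vertex v with label i (disjoint union)
--   join i j     : η_{i,j}, add all edges between label-i and label-j vertices (i ≠ j)
--   relabel i j  : ρ_{i→j}, relabel every label-i vertex to label j

data LOp (V : Set) (k : ℕ) : Set where
  intro   : V → Fin k → LOp V k
  join    : (i j : Fin k) → i ≢ j → LOp V k
  relabel : Fin k → Fin k → LOp V k

record LState (V : Set) (k : ℕ) : Set where
  field
    label : V → Maybe (Fin k)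
    edge  : V → V → Bool
open LState public

hasLabel : ∀ {k} → Maybe (Fin k) → Fin k → Bool
hasLabel nothing  _ = false
hasLabel (just l) i = does (l Fin.≟ i)

step : ∀ {V k} → DecidableEquality V → LState V k → LOp V k → LState V k
step _≟_ s (intro v i) = record
  { label = λ w → if does (w ≟ v) then just i else label s w
  ; edge  = edge s }
step _≟_ s (join i j _) = record
  { label = label s
  ; edge  = λ u w → edge s u w
                    ∨ (hasLabel (label s u) i ∧ hasLabel (label s w) j)
                    ∨ (hasLabel (label s u) j ∧ hasLabel (label s w) i) }
step _≟_ s (relabel i j) = record
  { label = λ w → Maybe.map (λ l → if does (l Fin.≟ i) then j else l) (label s w)
  ; edge  = edge s }

initState : ∀ {V k} → LState V k
initState = record { label = λ _ → nothing ; edge = λ _ _ → false }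

run : ∀ {V k} → DecidableEquality V → List (LOp V k) → LState V k
run _≟_ ops = foldl (step _≟_) initState ops

introCount : ∀ {V k} → DecidableEquality V → V → List (LOp V k) → ℕ
introCount _≟_ v [] = 0
introCount _≟_ v (intro w _ ∷ ops) =
  (if does (v ≟ w) then 1 else 0) + introCount _≟_ v ops
introCount _≟_ v (join _ _ _ ∷ ops) = introCount _≟_ v ops
introCount _≟_ v (relabel _ _ ∷ ops) = introCount _≟_ v ops

LinCWAtMost : ℕ → (V : Set) → DecidableEquality V → (V → V → Set) → Set
LinCWAtMost k V _≟_ Adj = ∃ λ (ops : List (LOp V k)) →
  (∀ v → introCount _≟_ v ops ≡ 1) ×
  (∀ u v → (edge (run _≟_ ops) u v ≡ true) ⇔ Adj u v)

-- The construction.  The sequence a is indexed by 1..3m (a : ℕ → ℕ, values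
-- outside [1,3m] are irrelevant).

range1 : ℕ → List ℕ
range1 n = map suc (upTo n)

sumRange : ℕ → (ℕ → ℕ) → ℕ
sumRange zero    f = 0
sumRange (suc n) f = sumRange n f + f (suc n)

module Construction (m B : ℕ) (a : ℕ → ℕ) where

  n : ℕ
  n = 3 * m

  aTop : ℕ
  aTop = a n

  k : ℕ
  k = 3 * B

  zSize : ℕ
  zSize = k ∸ aTop + 1

  γ : ℕ → ℕ
  γ i = length (filter (λ j → i ≤? a j) (range1 n))

  -- vertices: x_{i+1} ↦ inj₁ i, y_{i+1} ↦ inj₂ (inj₁ i), z_{i+1} ↦ inj₂ (inj₂ i)
  VG : Set
  VG = Fin n ⊎ (Fin aTop ⊎ Fin zSize)

  _≟VG_ : DecidableEquality VG
  _≟VG_ = ≡-dec Fin._≟_ (≡-dec Fin._≟_ Fin._≟_)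

  -- {x_i, y_j} with j ≤ a_i   (1-based indices i = toℕ x + 1, j = toℕ y + 1)
  XY : Fin n → Fin aTop → Set
  XY x y = suc (toℕ y) ≤ a (suc (toℕ x))

  -- {y_i, z_j}: i ∈ [m], j ≤ |Z| - B - 12m + 15 ; or i ∈ [m+1, a_{3m}], j ≤ |Z| - γ_i
  -- (|Z| - B - 12m + 15 is computed as (|Z| + 15) ∸ (B + 12m); since j ≥ 1 this
  --  agrees with the integer reading.)
  YZ : Fin aTop → Fin zSize → Set
  YZ y z =
    (suc (toℕ y) ≤ m × suc (toℕ z) ≤ (zSize + 15) ∸ (B + 12 * m)) ⊎
    (m < suc (toℕ y) × suc (toℕ z) ≤ zSize ∸ γ (suc (toℕ y)))

  AdjG : VG → VG → Set
  AdjG (inj₁ i)        (inj₁ j)        = i ≢ j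
  AdjG (inj₂ (inj₁ i)) (inj₂ (inj₁ j)) = i ≢ j
  AdjG (inj₂ (inj₂ i)) (inj₂ (inj₂ j)) = i ≢ j
  AdjG (inj₁ i)        (inj₂ (inj₁ j)) = XY i j
  AdjG (inj₂ (inj₁ j)) (inj₁ i)        = XY i j
  AdjG (inj₂ (inj₁ i)) (inj₂ (inj₂ j)) = YZ i j
  AdjG (inj₂ (inj₂ j)) (inj₂ (inj₁ i)) = YZ i j
  AdjG (inj₁ _)        (inj₂ (inj₂ _)) = ⊥
  AdjG (inj₂ (inj₂ _)) (inj₁ _)        = ⊥

{-# OPTIONS --safe #-}
module Submission where

-- The vertices lie on a line in the order x₁ … x₃ₘ, y₁ … y_{a₃ₘ}, z₁ … z_{|Z|}: xᵢ spans
-- [i, 3m + aᵢ], yⱼ spans [3m + j, 3m + a₃ₘ + tⱼ], where z₁ … z_{tⱼ} are the neighbours of yⱼ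
-- in Z, and z_l spans [3m + a₃ₘ + l, 3m + a₃ₘ + |Z|].  Right ends grow with left ends because
-- a is sorted and tⱼ is nondecreasing in j (γ is antitone, and B ≥ 15 keeps the threshold of
-- y₁ … yₘ below the others), and a small perturbation then makes the interval model proper.
--
-- For linear clique-width, order the vertices so that yⱼ precedes xᵢ iff j ≤ aᵢ, and z_l
-- precedes yⱼ iff l ≤ tⱼ.  Then every new x is adjacent to exactly the earlier x's and y's, a
-- new y to the earlier y's and z's, and a new z to the earlier z's.  So a linear 4-expression
-- can introduce each vertex with the private label 0, join label 0 to the labels of those
-- classes, and relabel it to the label of its own class.

open import Defs
open import Data.Nat using (ℕ; suc; _+_; _*_; _∸_; _≤_; _<_; _≤?_; z≤n; s≤s; z<s; >-nonZero)
open import Data.Nat.Properties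
open import Data.Integer using (+≤+)
import Data.Integer as ℤ
import Data.Integer.Properties as ℤ
open import Data.Rational using (ℚ; mkℚ; *≤*) renaming (_≤_ to _≤ℚ_)
import Data.Nat.Coprimality as Coprimality
open import Data.Fin using (Fin; zero; suc; toℕ)
import Data.Fin as Fin
open import Data.Fin.Properties using (toℕ<n; +↔⊎)
open import Data.Bool using (Bool; true; false; if_then_else_; _∨_; _∧_)
open import Data.Bool.Properties using (∨-identityʳ; ∧-zeroʳ; ∧-identityʳ)
open import Data.Bool.Solver using (module ∨-∧-Solver)
open import Data.Maybe using (Maybe; just; nothing)
open import Data.List using (List; []; _∷_; _++_; map; foldl; concatMap; tabulate; upTo)
open import Data.List.Properties using (foldl-++; length-filter; length-map; length-upTo)
open import Data.List.Relation.Unary.All using (All)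
import Data.List.Relation.Unary.All as All
open import Data.List.Relation.Unary.Any using (here; there)
open import Data.List.Relation.Unary.AllPairs using (AllPairs; _∷_)
import Data.List.Relation.Unary.AllPairs as AllPairs
open import Data.List.Relation.Unary.Linked.Properties using (Linked⇒AllPairs)
open import Data.List.Relation.Unary.Unique.Propositional using (Unique)
open import Data.List.Relation.Unary.Unique.Propositional.Properties
  using (Unique[x∷xs]⇒x∉xs; tabulate⁺)
open import Data.List.Relation.Binary.Permutation.Propositional using (↭-sym; ↭⇒↭ₛ)
open import Data.List.Relation.Binary.Permutation.Propositional.Properties using (∈-resp-↭)
import Data.List.Relation.Binary.Permutation.Setoid.Properties as Permutation
open import Data.List.Relation.Binary.Sublist.Propositional using (⊆-refl)
open import Data.List.Relation.Binary.Sublist.Propositional.Properties using (filter⁺; length-mono-≤)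
open import Data.List.Membership.Propositional using (_∈_; _∉_)
open import Data.List.Membership.Propositional.Properties using (∈-tabulate⁺)
import Data.List.Membership.DecPropositional as DecMembership
open import Data.Product using (_×_; _,_; proj₂; swap)
open import Data.Product.Function.NonDependent.Propositional using (_×-⇔_)
open import Data.Sum using (inj₁; inj₂)
open import Data.Sum.Function.Propositional using (_⊎-↔_)
open import Function using (_∘_)
open import Function.Bundles using (_⇔_; _↔_; mk⇔; Equivalence; Inverse; Injection)
open import Function.Construct.Composition using (_⇔-∘_; _↔-∘_)
open import Function.Construct.Identity using (↔-id)
open import Function.Construct.Symmetry using (⇔-sym)
open import Function.Properties.Inverse using (Inverse⇒Injection)
open import Relation.Binary.Definitions using (DecidableEquality)
import Relation.Binary.Construct.On as On
open import Relation.Binary.PropositionalEquality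
open import Relation.Nullary using (Dec; yes; no; does; ¬_; contradiction)
open import Relation.Nullary.Decidable using (dec-true; dec-false; does-⇔; ¬?)
import Relation.Nullary.Decidable as Dec

both⇔ : ∀ {A B : Set} → A → B → A ⇔ B
both⇔ a b = mk⇔ (λ _ → b) (λ _ → a)

neither⇔ : ∀ {A B : Set} → ¬ A → ¬ B → A ⇔ B
neither⇔ ¬a ¬b = mk⇔ (λ a → contradiction a ¬a) (λ b → contradiction b ¬b)

does≡true⇔ : ∀ {A : Set} (a? : Dec A) → does a? ≡ true ⇔ A
does≡true⇔ (yes a)  = mk⇔ (λ _ → a) (λ _ → refl)
does≡true⇔ (no ¬a) = mk⇔ (λ ()) (λ a → contradiction a ¬a)

ℕ→ℚ : ℕ → ℚ
ℕ→ℚ n = mkℚ (ℤ.+ n) 0 (Coprimality.sym (Coprimality.1-coprimeTo n))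

ℕ→ℚ-≤⇔ : ∀ {m n} → ℕ→ℚ m ≤ℚ ℕ→ℚ n ⇔ m ≤ n
ℕ→ℚ-≤⇔ {m} {n} = mk⇔
  (λ { (*≤* le) → ℤ.drop‿+≤+ (subst₂ ℤ._≤_ (k*1≡k m) (k*1≡k n) le) })
  (λ le → *≤* (subst₂ ℤ._≤_ (sym (k*1≡k m)) (sym (k*1≡k n)) (+≤+ le)))
  where
  k*1≡k : ∀ k → ℤ.+ k ℤ.* ℤ.+ 1 ≡ ℤ.+ k
  k*1≡k k = ℤ.*-identityʳ (ℤ.+ k)

*-+-≤⇔ : ∀ K {a b c} → c < K → K * a ≤ K * b + c ⇔ a ≤ b
*-+-≤⇔ K {a} {b} {c} c<K = mk⇔
  (λ le → m<1+n⇒m≤n (*-cancelˡ-< K a (suc b) (≤-<-trans le below-next)))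
  (λ le → ≤-trans (*-monoʳ-≤ K le) (m≤m+n (K * b) c))
  where
  below-next : K * b + c < K * suc b
  below-next = subst (K * b + c <_) (trans (+-comm (K * b) K) (sym (*-suc K b)))
    (+-monoʳ-< (K * b) c<K)

properIntervalGraph-strict : {V : Set} {Adj : V → V → Set} (left right : V → ℕ) →
  (∀ v → left v ≤ right v) →
  (∀ u v → u ≢ v → Adj u v ⇔ (left u ≤ right v × left v ≤ right u)) →
  (∀ u v → left u ≤ left v → right u ≤ right v) →
  (∀ u v → left u < left v → right u < right v) →
  IsProperIntervalGraph V Adj
properIntervalGraph-strict {V} {Adj} left right left≤right adjacent⇔ right-mono right-strict =
  interval , (λ v → Equivalence.from ℕ→ℚ-≤⇔ (left≤right v)) , intersects , ¬contains
  where
  interval : V → Interval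
  interval v = ℕ→ℚ (left v) , ℕ→ℚ (right v)

  intersects : ∀ u v → u ≢ v → Adj u v ⇔ Intersect (interval u) (interval v)
  intersects u v u≢v = (⇔-sym ℕ→ℚ-≤⇔ ×-⇔ ⇔-sym ℕ→ℚ-≤⇔) ⇔-∘ adjacent⇔ u v u≢v

  ¬contains : ∀ u v → ¬ ProperlyContains (interval u) (interval v)
  ¬contains u v (lu≤lv , rv≤ru , different) with m≤n⇒m<n∨m≡n (Equivalence.to ℕ→ℚ-≤⇔ lu≤lv)
  ... | inj₁ lu<lv = <⇒≱ (right-strict u v lu<lv) (Equivalence.to ℕ→ℚ-≤⇔ rv≤ru)
  ... | inj₂ lu≡lv = different (cong ℕ→ℚ lu≡lv , cong ℕ→ℚ ru≡rv)
    where
    ru≡rv : right u ≡ right v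
    ru≡rv = ≤-antisym (right-mono u v (≤-reflexive lu≡lv)) (Equivalence.to ℕ→ℚ-≤⇔ rv≤ru)

-- Scaling by K and adding left v < K to the right end makes right ends strictly monotone
-- without changing which intervals meet.
properIntervalGraph : {V : Set} {Adj : V → V → Set} (K : ℕ) (left right : V → ℕ) →
  (∀ v → left v < K) →
  (∀ v → left v ≤ right v) →
  (∀ u v → u ≢ v → Adj u v ⇔ (left u ≤ right v × left v ≤ right u)) →
  (∀ u v → left u ≤ left v → right u ≤ right v) →
  IsProperIntervalGraph V Adj
properIntervalGraph {V} {Adj} K left right left<K left≤right adjacent⇔ right-mono =
  properIntervalGraph-strict left′ right′ left′≤right′ adjacent′⇔ right′-mono right′-strict
  where
  left′ right′ : V → ℕ
  left′ v = K * left v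
  right′ v = K * right v + left v

  left′≤right′⇔ : ∀ u v → left′ u ≤ right′ v ⇔ left u ≤ right v
  left′≤right′⇔ u v = *-+-≤⇔ K (left<K v)

  left′≤right′ : ∀ v → left′ v ≤ right′ v
  left′≤right′ v = Equivalence.from (left′≤right′⇔ v v) (left≤right v)

  adjacent′⇔ : ∀ u v → u ≢ v → Adj u v ⇔ (left′ u ≤ right′ v × left′ v ≤ right′ u)
  adjacent′⇔ u v u≢v =
    (⇔-sym (left′≤right′⇔ u v) ×-⇔ ⇔-sym (left′≤right′⇔ v u)) ⇔-∘ adjacent⇔ u v u≢v

  right′-mono : ∀ u v → left′ u ≤ left′ v → right′ u ≤ right′ v
  right′-mono u v le = +-mono-≤ (*-monoʳ-≤ K (right-mono u v lu≤lv)) lu≤lv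
    where
    lu≤lv : left u ≤ left v
    lu≤lv = *-cancelˡ-≤ K {{>-nonZero (≤-<-trans z≤n (left<K u))}} le

  right′-strict : ∀ u v → left′ u < left′ v → right′ u < right′ v
  right′-strict u v lt = +-mono-≤-< (*-monoʳ-≤ K (right-mono u v (<⇒≤ lu<lv))) lu<lv
    where
    lu<lv : left u < left v
    lu<lv = *-cancelˡ-< K (left u) (left v) lt

-- Label zero belongs to the vertex being introduced; label suc c collects the vertices of class c.
module LinearExpression {V : Set} (_≟_ : DecidableEquality V)
  {Adj : V → V → Set} (Adj? : ∀ u v → Dec (Adj u v))
  (Adj-sym : ∀ {u v} → Adj u v → Adj v u) (Adj-irrefl : ∀ {v} → ¬ Adj v v)
  {k : ℕ} (class : V → Fin k) (targets : Fin k → List (Fin k))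
  where

  module Classes = DecMembership (Fin._≟_ {k})
  module Vertices = DecMembership _≟_

  State : Set
  State = LState V (suc k)

  runFrom : State → List (LOp V (suc k)) → State
  runFrom = foldl (step _≟_)

  joinFresh : Fin k → LOp V (suc k)
  joinFresh c = join zero (suc c) (λ ())

  isFresh : State → V → Bool
  isFresh s v = hasLabel (label s v) zero

  labelIn : Maybe (Fin (suc k)) → List (Fin k) → Bool
  labelIn (just (suc c)) cs = does (c Classes.∈? cs)
  labelIn _              cs = false

  labelIn-[] : ∀ l → labelIn l [] ≡ false
  labelIn-[] nothing        = refl
  labelIn-[] (just zero)    = refl
  labelIn-[] (just (suc l)) = refl

  labelIn-∷ : ∀ l c cs → labelIn l (c ∷ cs) ≡ hasLabel l (suc c) ∨ labelIn l cs
  labelIn-∷ nothing        c cs = refl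
  labelIn-∷ (just zero)    c cs = refl
  labelIn-∷ (just (suc l)) c cs = refl

  label-joins : ∀ cs s → label (runFrom s (map joinFresh cs)) ≡ label s
  label-joins []       s = refl
  label-joins (c ∷ cs) s = label-joins cs (step _≟_ s (joinFresh c))

  edge-joins : ∀ cs s u v → edge (runFrom s (map joinFresh cs)) u v ≡
    edge s u v ∨ (isFresh s u ∧ labelIn (label s v) cs) ∨ (labelIn (label s u) cs ∧ isFresh s v)
  edge-joins [] s u v rewrite labelIn-[] (label s u) | labelIn-[] (label s v) =
    solve 3 (λ e a b → e := e :+ ((a :* con false) :+ (con false :* b))) refl
      (edge s u v) (isFresh s u) (isFresh s v)
    where open ∨-∧-Solver
  edge-joins (c ∷ cs) s u v = begin
    edge (runFrom (step _≟_ s (joinFresh c)) (map joinFresh cs)) u v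
      ≡⟨ edge-joins cs (step _≟_ s (joinFresh c)) u v ⟩
    (edge s u v ∨ (fu ∧ hv) ∨ (hu ∧ fv)) ∨ (fu ∧ iv) ∨ (iu ∧ fv)
      ≡⟨ solve 7 (λ e fu fv hu hv iu iv →
           (e :+ ((fu :* hv) :+ (hu :* fv))) :+ ((fu :* iv) :+ (iu :* fv))
             := e :+ ((fu :* (hv :+ iv)) :+ ((hu :+ iu) :* fv)))
           refl (edge s u v) fu fv hu hv iu iv ⟩
    edge s u v ∨ (fu ∧ (hv ∨ iv)) ∨ ((hu ∨ iu) ∧ fv)
      ≡⟨ sym (cong₂ (λ x y → edge s u v ∨ (fu ∧ x) ∨ (y ∧ fv))
           (labelIn-∷ (label s v) c cs) (labelIn-∷ (label s u) c cs)) ⟩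
    edge s u v ∨ (fu ∧ labelIn (label s v) (c ∷ cs)) ∨ (labelIn (label s u) (c ∷ cs) ∧ fv) ∎
    where
    open ≡-Reasoning
    open ∨-∧-Solver
    fu fv hu hv iu iv : Bool
    fu = isFresh s u
    fv = isFresh s v
    hu = hasLabel (label s u) (suc c)
    hv = hasLabel (label s v) (suc c)
    iu = labelIn (label s u) cs
    iv = labelIn (label s v) cs

  record Realises (s : State) (seen : V → Bool) : Set where
    field
      label-seen : ∀ v → label s v ≡ (if seen v then just (suc (class v)) else nothing)
      edge-seen  : ∀ u v → edge s u v ≡ (seen u ∧ seen v ∧ does (Adj? u v))

  realises-cong : ∀ {s seen₁ seen₂} → (∀ v → seen₁ v ≡ seen₂ v) →
    Realises s seen₁ → Realises s seen₂
  realises-cong eq r = record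
    { label-seen = λ v →
        trans (label-seen v) (cong (λ b → if b then just (suc (class v)) else nothing) (eq v))
    ; edge-seen  = λ u v →
        trans (edge-seen u v) (cong₂ (λ a b → a ∧ b ∧ does (Adj? u v)) (eq u) (eq v)) }
    where open Realises r

  Compatible : V → V → Set
  Compatible u w = Adj u w ⇔ class u ∈ targets (class w)

  does-Adj?-comm : ∀ u v → does (Adj? u v) ≡ does (Adj? v u)
  does-Adj?-comm u v = does-⇔ (mk⇔ Adj-sym Adj-sym) (Adj? u v) (Adj? v u)

  block : V → List (LOp V (suc k))
  block w = intro w zero ∷ map joinFresh (targets (class w)) ++ relabel zero (suc (class w)) ∷ []

  module _ {s seen w} (r : Realises s seen) (unseen : seen w ≡ false)
    (compatible : ∀ u → seen u ≡ true → Compatible u w) where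

    open Realises r

    private
      cs : List (Fin k)
      cs = targets (class w)

      introduced joined : State
      introduced = step _≟_ s (intro w zero)
      joined = runFrom introduced (map joinFresh cs)

    run-block : runFrom s (block w) ≡ step _≟_ joined (relabel zero (suc (class w)))
    run-block = foldl-++ (step _≟_) introduced (map joinFresh cs) _

    linked : V → Bool
    linked v = seen v ∧ does (Adj? w v)

    isFresh-introduced : ∀ v → isFresh introduced v ≡ does (v ≟ w)
    isFresh-introduced v with v ≟ w
    ... | yes _ = refl
    ... | no _ rewrite label-seen v with seen v
    ...   | true  = refl
    ...   | false = refl

    labelIn-introduced : ∀ v → labelIn (label introduced v) cs ≡ linked v
    labelIn-introduced v with v ≟ w
    ... | yes refl rewrite unseen = refl
    ... | no _ rewrite label-seen v with seen v in seen-v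
    ...   | true  = does-⇔ (mk⇔ Adj-sym Adj-sym ⇔-∘ ⇔-sym (compatible v seen-v))
                      (class v Classes.∈? cs) (Adj? w v)
    ...   | false = refl

    edge-block : ∀ u v → edge (runFrom s (block w)) u v ≡
      edge s u v ∨ (does (u ≟ w) ∧ linked v) ∨ (linked u ∧ does (v ≟ w))
    edge-block u v rewrite run-block | edge-joins cs introduced u v
      | isFresh-introduced u | isFresh-introduced v
      | labelIn-introduced u | labelIn-introduced v = refl

    edge-block-seen : ∀ u v →
      edge s u v ∨ (does (u ≟ w) ∧ linked v) ∨ (linked u ∧ does (v ≟ w)) ≡
      (does (u ≟ w) ∨ seen u) ∧ (does (v ≟ w) ∨ seen v) ∧ does (Adj? u v)
    edge-block-seen u v with u ≟ w | v ≟ w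
    ... | yes refl | yes refl
      rewrite edge-seen w w | unseen | dec-false (Adj? w w) Adj-irrefl = refl
    ... | yes refl | no _
      rewrite edge-seen w v | unseen = ∨-identityʳ (linked v)
    ... | no _     | yes refl
      rewrite edge-seen u w | unseen | ∧-zeroʳ (seen u) | ∧-identityʳ (linked u) =
      cong (seen u ∧_) (does-Adj?-comm w u)
    ... | no _     | no _
      rewrite ∧-zeroʳ (linked u) | ∨-identityʳ (edge s u v) = edge-seen u v

    realises-block : Realises (runFrom s (block w)) (λ v → does (v ≟ w) ∨ seen v)
    realises-block = record
      { label-seen = label-block
      ; edge-seen  = λ u v → trans (edge-block u v) (edge-block-seen u v) }
      where
      label-block : ∀ v → label (runFrom s (block w)) v ≡
        (if does (v ≟ w) ∨ seen v then just (suc (class v)) else nothing)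
      label-block v rewrite run-block | label-joins cs introduced with v ≟ w
      ... | yes refl = refl
      ... | no _ rewrite label-seen v with seen v
      ...   | true  = refl
      ...   | false = refl

  expression : List V → List (LOp V (suc k))
  expression = concatMap block

  realises-expression : ∀ σ {s seen} → Realises s seen →
    Unique σ → (∀ v → seen v ≡ true → v ∉ σ) →
    AllPairs Compatible σ → (∀ u → seen u ≡ true → All (Compatible u) σ) →
    Realises (runFrom s (expression σ)) (λ v → seen v ∨ does (v Vertices.∈? σ))
  realises-expression [] r _ _ _ _ = realises-cong (λ v → sym (∨-identityʳ _)) r
  realises-expression (w ∷ σ) {s} {seen} r uniq fresh (w-compatible ∷ compatible) earlier
    rewrite foldl-++ (step _≟_) s (block w) (expression σ) =
    realises-cong reorder
      (realises-expression σ (realises-block r unseen (λ u seen-u → All.head (earlier u seen-u)))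
        (AllPairs.tail uniq) fresh-σ compatible earlier-σ)
    where
    unseen : seen w ≡ false
    unseen with seen w in seen-w
    ... | true  = contradiction (here refl) (fresh w seen-w)
    ... | false = refl

    fresh-σ : ∀ v → does (v ≟ w) ∨ seen v ≡ true → v ∉ σ
    fresh-σ v seen-v with v ≟ w
    ... | yes refl = Unique[x∷xs]⇒x∉xs uniq
    ... | no _     = fresh v seen-v ∘ there

    earlier-σ : ∀ u → does (u ≟ w) ∨ seen u ≡ true → All (Compatible u) σ
    earlier-σ u seen-u with u ≟ w
    ... | yes refl = w-compatible
    ... | no _     = All.tail (earlier u seen-u)

    reorder : ∀ v → (does (v ≟ w) ∨ seen v) ∨ does (v Vertices.∈? σ) ≡
      seen v ∨ does (v Vertices.∈? (w ∷ σ))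
    reorder v = solve 3 (λ a b c → (a :+ b) :+ c := b :+ (a :+ c)) refl
      (does (v ≟ w)) (seen v) (does (v Vertices.∈? σ))
      where open ∨-∧-Solver

  introCount-++ : ∀ v (xs ys : List (LOp V (suc k))) →
    introCount _≟_ v (xs ++ ys) ≡ introCount _≟_ v xs + introCount _≟_ v ys
  introCount-++ v []                 ys = refl
  introCount-++ v (intro w _ ∷ xs)   ys =
    trans (cong (_ +_) (introCount-++ v xs ys)) (sym (+-assoc (if does (v ≟ w) then 1 else 0) _ _))
  introCount-++ v (join _ _ _ ∷ xs)  ys = introCount-++ v xs ys
  introCount-++ v (relabel _ _ ∷ xs) ys = introCount-++ v xs ys

  introCount-joins : ∀ v cs (ops : List (LOp V (suc k))) →
    introCount _≟_ v (map joinFresh cs ++ ops) ≡ introCount _≟_ v ops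
  introCount-joins v []       ops = refl
  introCount-joins v (c ∷ cs) ops = introCount-joins v cs ops

  introCount-block : ∀ v w → introCount _≟_ v (block w) ≡ (if does (v ≟ w) then 1 else 0)
  introCount-block v w =
    trans (cong (_ +_) (introCount-joins v (targets (class w)) _)) (+-identityʳ _)

  introCount-expression-∷ : ∀ v w σ → introCount _≟_ v (expression (w ∷ σ)) ≡
    (if does (v ≟ w) then 1 else 0) + introCount _≟_ v (expression σ)
  introCount-expression-∷ v w σ =
    trans (introCount-++ v (block w) (expression σ)) (cong (_+ _) (introCount-block v w))

  introCount-expression-∉ : ∀ v σ → v ∉ σ → introCount _≟_ v (expression σ) ≡ 0
  introCount-expression-∉ v []      v∉σ = refl
  introCount-expression-∉ v (w ∷ σ) v∉σ rewrite introCount-expression-∷ v w σ with v ≟ w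
  ... | yes refl = contradiction (here refl) v∉σ
  ... | no _     = introCount-expression-∉ v σ (v∉σ ∘ there)

  introCount-expression-∈ : ∀ v σ → Unique σ → v ∈ σ → introCount _≟_ v (expression σ) ≡ 1
  introCount-expression-∈ v (w ∷ σ) uniq v∈σ
    rewrite introCount-expression-∷ v w σ with v ≟ w | v∈σ
  ... | yes refl | _          = cong suc (introCount-expression-∉ v σ (Unique[x∷xs]⇒x∉xs uniq))
  ... | no v≢w   | here v≡w   = contradiction v≡w v≢w
  ... | no _     | there v∈σ′ = introCount-expression-∈ v σ (AllPairs.tail uniq) v∈σ′

  linCW-fromOrdering : (σ : List V) → Unique σ → (∀ v → v ∈ σ) → AllPairs Compatible σ →
    LinCWAtMost (suc k) V _≟_ Adj
  linCW-fromOrdering σ uniq complete compatible =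
    expression σ , (λ v → introCount-expression-∈ v σ uniq (complete v)) , edges
    where
    realises : Realises (run _≟_ (expression σ)) (λ v → false ∨ does (v Vertices.∈? σ))
    realises = realises-expression σ (record { label-seen = λ _ → refl ; edge-seen = λ _ _ → refl })
      uniq (λ _ ()) compatible (λ _ ())

    edges : ∀ u v → (edge (run _≟_ (expression σ)) u v ≡ true) ⇔ Adj u v
    edges u v rewrite Realises.edge-seen realises u v
      | dec-true (u Vertices.∈? σ) (complete u) | dec-true (v Vertices.∈? σ) (complete v) =
      does≡true⇔ (Adj? u v)

module _ {V : Set} {N : ℕ} (enumeration : Fin N ↔ V) (key : V → ℕ) where

  open import Data.List.Sort (On.decTotalOrder ≤-decTotalOrder key) using (sort; sort-↭; sort-↗)

  sortedBy : List V
  sortedBy = sort (tabulate (Inverse.to enumeration))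

  sortedBy-unique : Unique sortedBy
  sortedBy-unique = Permutation.Unique-resp-↭ (setoid V) (↭⇒↭ₛ (↭-sym (sort-↭ _)))
    (tabulate⁺ (Injection.injective (Inverse⇒Injection enumeration)))

  sortedBy-complete : ∀ v → v ∈ sortedBy
  sortedBy-complete v = ∈-resp-↭ (↭-sym (sort-↭ _))
    (subst (_∈ _) (Inverse.strictlyInverseˡ enumeration v) (∈-tabulate⁺ (Inverse.from enumeration v)))

  sortedBy-sorted : AllPairs (λ u w → key u ≤ key w) sortedBy
  sortedBy-sorted = Linked⇒AllPairs ≤-trans (sort-↗ _)

index : ∀ {k} → Fin k → ℕ
index i = suc (toℕ i)

pattern X i = inj₁ i
pattern Y j = inj₂ (inj₁ j)
pattern Z l = inj₂ (inj₂ l)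

pattern cX = zero
pattern cY = suc zero
pattern cZ = suc (suc zero)

module ConstructedGraph (m B : ℕ) (a : ℕ → ℕ)
  (a-mono : ∀ i j → 1 ≤ i → i ≤ j → j ≤ 3 * m → a i ≤ a j)
  (B≥15 : 15 ≤ B)
  where

  open Construction m B a

  headThreshold : ℕ
  headThreshold = (zSize + 15) ∸ (B + 12 * m)

  threshold : ℕ → ℕ
  threshold j with j ≤? m
  ... | yes _ = headThreshold
  ... | no _  = zSize ∸ γ j

  YZ⇔ : ∀ y z → YZ y z ⇔ index z ≤ threshold (index y)
  YZ⇔ y z with index y ≤? m
  ... | yes y≤m = mk⇔ (λ { (inj₁ (_ , z≤t)) → z≤t ; (inj₂ (m<y , _)) → contradiction y≤m (<⇒≱ m<y) })
                      (λ z≤t → inj₁ (y≤m , z≤t))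
  ... | no y≰m  = mk⇔ (λ { (inj₁ (y≤m , _)) → contradiction y≤m y≰m ; (inj₂ (_ , z≤t)) → z≤t })
                      (λ z≤t → inj₂ (≰⇒> y≰m , z≤t))

  γ≤n : ∀ j → γ j ≤ n
  γ≤n j = ≤-trans (length-filter _ (range1 n))
    (≤-reflexive (trans (length-map suc (upTo n)) (length-upTo n)))

  γ-antitone : ∀ {i j} → i ≤ j → γ j ≤ γ i
  γ-antitone {i} {j} i≤j = length-mono-≤ (filter⁺ (λ l → j ≤? a l) (λ l → i ≤? a l)
    (λ { refl j≤a → ≤-trans i≤j j≤a }) (⊆-refl {x = range1 n}))

  headThreshold≤ : headThreshold ≤ zSize ∸ n
  headThreshold≤ = begin
    (zSize + 15) ∸ (B + 12 * m) ≤⟨ ∸-monoʳ-≤ (zSize + 15) (+-mono-≤ B≥15 3m≤12m) ⟩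
    (zSize + 15) ∸ (15 + n)     ≡⟨ cong (_∸ (15 + n)) (+-comm zSize 15) ⟩
    (15 + zSize) ∸ (15 + n)     ≡⟨ [m+n]∸[m+o]≡n∸o 15 zSize n ⟩
    zSize ∸ n                   ∎
    where
    open ≤-Reasoning
    3m≤12m : 3 * m ≤ 12 * m
    3m≤12m = *-monoˡ-≤ m {3} {12} (s≤s (s≤s (s≤s z≤n)))

  threshold-mono : ∀ {i j} → i ≤ j → threshold i ≤ threshold j
  threshold-mono {i} {j} i≤j with i ≤? m | j ≤? m
  ... | yes _   | yes _   = ≤-refl
  ... | yes _   | no _    = ≤-trans headThreshold≤ (∸-monoʳ-≤ zSize (γ≤n j))
  ... | no i≰m  | yes j≤m = contradiction (≤-trans i≤j j≤m) i≰m
  ... | no _    | no _    = ∸-monoʳ-≤ zSize (γ-antitone i≤j)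

  threshold≤zSize : ∀ j → threshold j ≤ zSize
  threshold≤zSize j with j ≤? m
  ... | yes _ = ≤-trans headThreshold≤ (m∸n≤m zSize n)
  ... | no _  = m∸n≤m zSize (γ j)

  a≤aTop : ∀ i → a (index i) ≤ aTop
  a≤aTop i = a-mono (index i) n (s≤s z≤n) (toℕ<n i) ≤-refl

  left right : VG → ℕ
  left (X i) = index i
  left (Y j) = n + index j
  left (Z l) = n + aTop + index l
  right (X i) = n + a (index i)
  right (Y j) = n + aTop + threshold (index j)
  right (Z l) = n + aTop + zSize

  left-Y≤ : ∀ j → left (Y j) ≤ n + aTop
  left-Y≤ j = +-monoʳ-≤ n (toℕ<n j)

  <left-Z : ∀ l → n + aTop < left (Z l)
  <left-Z l = m<m+n (n + aTop) z<s

  right-X≤ : ∀ i → right (X i) ≤ n + aTop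
  right-X≤ i = +-monoʳ-≤ n (a≤aTop i)

  n≤right : ∀ v → n ≤ right v
  n≤right (X i) = m≤m+n n _
  n≤right (Y j) = ≤-trans (m≤m+n n aTop) (m≤m+n _ _)
  n≤right (Z l) = ≤-trans (m≤m+n n aTop) (m≤m+n _ _)

  left-X≤right : ∀ i v → left (X i) ≤ right v
  left-X≤right i v = ≤-trans (toℕ<n i) (n≤right v)

  left≤right : ∀ v → left v ≤ right v
  left≤right (X i) = left-X≤right i (X i)
  left≤right (Y j) = ≤-trans (left-Y≤ j) (m≤m+n _ _)
  left≤right (Z l) = +-monoʳ-≤ (n + aTop) (toℕ<n l)

  right≤ : ∀ v → right v ≤ n + aTop + zSize
  right≤ (X i) = ≤-trans (right-X≤ i) (m≤m+n _ _)
  right≤ (Y j) = +-monoʳ-≤ (n + aTop) (threshold≤zSize (index j))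
  right≤ (Z l) = ≤-refl

  adjacent⇔ : ∀ u v → u ≢ v → AdjG u v ⇔ (left u ≤ right v × left v ≤ right u)
  adjacent⇔ (X i) (X i′) u≢v =
    mk⇔ (λ _ → left-X≤right i (X i′) , left-X≤right i′ (X i)) (λ _ → u≢v ∘ cong X)
  adjacent⇔ (X i) (Y j)  _   =
    mk⇔ (λ j≤a → left-X≤right i (Y j) , +-monoʳ-≤ n j≤a) (+-cancelˡ-≤ n _ _ ∘ proj₂)
  adjacent⇔ (X i) (Z l)  _   =
    mk⇔ (λ ()) (λ (_ , l≤a) → <⇒≱ (≤-<-trans (right-X≤ i) (<left-Z l)) l≤a)
  adjacent⇔ (Y j) (Y j′) u≢v =
    mk⇔ (λ _ → ≤-trans (left-Y≤ j) (m≤m+n _ _) , ≤-trans (left-Y≤ j′) (m≤m+n _ _))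
        (λ _ → u≢v ∘ cong Y)
  adjacent⇔ (Y j) (Z l)  _   =
    mk⇔ (λ yz → ≤-trans (left-Y≤ j) (m≤m+n _ _) , +-monoʳ-≤ (n + aTop) (Equivalence.to (YZ⇔ j l) yz))
        (Equivalence.from (YZ⇔ j l) ∘ +-cancelˡ-≤ (n + aTop) _ _ ∘ proj₂)
  adjacent⇔ (Z l) (Z l′) u≢v =
    mk⇔ (λ _ → left≤right (Z l) , left≤right (Z l′)) (λ _ → u≢v ∘ cong Z)
  adjacent⇔ (Y j) (X i)  v≢u = mk⇔ swap swap ⇔-∘ adjacent⇔ (X i) (Y j) (v≢u ∘ sym)
  adjacent⇔ (Z l) (X i)  v≢u = mk⇔ swap swap ⇔-∘ adjacent⇔ (X i) (Z l) (v≢u ∘ sym)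
  adjacent⇔ (Z l) (Y j)  v≢u = mk⇔ swap swap ⇔-∘ adjacent⇔ (Y j) (Z l) (v≢u ∘ sym)

  right-mono : ∀ u v → left u ≤ left v → right u ≤ right v
  right-mono (X i) (X i′) i≤i′ =
    +-monoʳ-≤ n (a-mono (index i) (index i′) (s≤s z≤n) i≤i′ (toℕ<n i′))
  right-mono (X i) (Y _)  _    = ≤-trans (right-X≤ i) (m≤m+n _ _)
  right-mono (X i) (Z _)  _    = ≤-trans (right-X≤ i) (m≤m+n _ _)
  right-mono (Y _) (Y _)  j≤j′ = +-monoʳ-≤ (n + aTop) (threshold-mono (+-cancelˡ-≤ n _ _ j≤j′))
  right-mono (Y j) (Z _)  _    = +-monoʳ-≤ (n + aTop) (threshold≤zSize (index j))
  right-mono (Z _) (Z _)  _    = ≤-refl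
  right-mono (Y j) (X i)  j≤i  =
    contradiction j≤i (<⇒≱ (≤-<-trans (toℕ<n i) (m<m+n n z<s)))
  right-mono (Z l) (X i)  l≤i  =
    contradiction l≤i (<⇒≱ (≤-<-trans (≤-trans (toℕ<n i) (m≤m+n n aTop)) (<left-Z l)))
  right-mono (Z l) (Y j)  l≤j  =
    contradiction l≤j (<⇒≱ (≤-<-trans (left-Y≤ j) (<left-Z l)))

  isProperIntervalGraph : IsProperIntervalGraph VG AdjG
  isProperIntervalGraph = properIntervalGraph (suc (n + aTop + zSize)) left right
    (λ v → s≤s (≤-trans (left≤right v) (right≤ v))) left≤right adjacent⇔ right-mono

  class : VG → Fin 3
  class (X _) = cX
  class (Y _) = cY
  class (Z _) = cZ

  targets : Fin 3 → List (Fin 3)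
  targets cX = cX ∷ cY ∷ []
  targets cY = cY ∷ cZ ∷ []
  targets cZ = cZ ∷ []

  -- yKey j encodes the pair (threshold j, j) lexicographically, as j < suc aTop.  Doubling leaves
  -- room to put xᵢ right after y_{aᵢ}, and z_l comes before exactly the yⱼ with l ≤ threshold j.
  yKey : ℕ → ℕ
  yKey j = j + threshold j * suc aTop

  key : VG → ℕ
  key (X i) = suc (2 * yKey (a (index i)))
  key (Y j) = 2 * yKey (index j)
  key (Z l) = 2 * (index l * suc aTop)

  yKey-mono : ∀ {i j} → i ≤ j → yKey i ≤ yKey j
  yKey-mono i≤j = +-mono-≤ i≤j (*-monoˡ-≤ (suc aTop) (threshold-mono i≤j))

  yKey-strict : ∀ {i j} → i < j → yKey i < yKey j
  yKey-strict i<j = +-mono-<-≤ i<j (*-monoˡ-≤ (suc aTop) (threshold-mono (<⇒≤ i<j)))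

  key-Y<key-X : ∀ {i j} → index j ≤ a (index i) → key (Y j) < key (X i)
  key-Y<key-X j≤a = s≤s (*-monoʳ-≤ 2 (yKey-mono j≤a))

  key-X<key-Y : ∀ {i j} → a (index i) < index j → key (X i) < key (Y j)
  key-X<key-Y {i} {j} a<j =
    subst (_≤ key (Y j)) (*-suc 2 (yKey (a (index i)))) (*-monoʳ-≤ 2 (yKey-strict a<j))

  key-Z<key-Y : ∀ {j l} → index l ≤ threshold (index j) → key (Z l) < key (Y j)
  key-Z<key-Y l≤t = *-monoʳ-< 2 (≤-<-trans (*-monoˡ-≤ (suc aTop) l≤t) (m<n+m _ z<s))

  key-Y<key-Z : ∀ {j l} → threshold (index j) < index l → key (Y j) < key (Z l)
  key-Y<key-Z {j} t<l =
    *-monoʳ-< 2 (<-≤-trans (+-monoˡ-< _ (s≤s (toℕ<n j))) (*-monoˡ-≤ (suc aTop) t<l))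

  compatible-byKey : ∀ u w → u ≢ w → key u ≤ key w → AdjG u w ⇔ class u ∈ targets (class w)
  compatible-byKey (X i) (X i′) u≢w _   = both⇔ (u≢w ∘ cong X) (here refl)
  compatible-byKey (X i) (Y j)  _   k≤k =
    neither⇔ (λ j≤a → <⇒≱ (key-Y<key-X j≤a) k≤k) λ { (here ()) ; (there (here ())) ; (there (there ())) }
  compatible-byKey (X i) (Z l)  _   _   = neither⇔ (λ ()) λ { (here ()) ; (there ()) }
  compatible-byKey (Y j) (X i)  _   k≤k =
    both⇔ (≮⇒≥ (λ a<j → <⇒≱ (key-X<key-Y a<j) k≤k)) (there (here refl))
  compatible-byKey (Y j) (Y j′) u≢w _   = both⇔ (u≢w ∘ cong Y) (here refl)
  compatible-byKey (Y j) (Z l)  _   k≤k =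
    neither⇔ (λ yz → <⇒≱ (key-Z<key-Y (Equivalence.to (YZ⇔ j l) yz)) k≤k) λ { (here ()) ; (there ()) }
  compatible-byKey (Z l) (X i)  _   _   =
    neither⇔ (λ ()) λ { (here ()) ; (there (here ())) ; (there (there ())) }
  compatible-byKey (Z l) (Y j)  _   k≤k =
    both⇔ (Equivalence.from (YZ⇔ j l) (≮⇒≥ (λ t<l → <⇒≱ (key-Y<key-Z t<l) k≤k))) (there (here refl))
  compatible-byKey (Z l) (Z l′) u≢w _   = both⇔ (u≢w ∘ cong Z) (here refl)

  adjacent? : ∀ u v → Dec (AdjG u v)
  adjacent? (X i) (X i′) = ¬? (i Fin.≟ i′)
  adjacent? (X i) (Y j)  = index j ≤? a (index i)
  adjacent? (X _) (Z _)  = no λ ()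
  adjacent? (Y j) (X i)  = index j ≤? a (index i)
  adjacent? (Y j) (Y j′) = ¬? (j Fin.≟ j′)
  adjacent? (Y j) (Z l)  = Dec.map (⇔-sym (YZ⇔ j l)) (index l ≤? threshold (index j))
  adjacent? (Z _) (X _)  = no λ ()
  adjacent? (Z l) (Y j)  = adjacent? (Y j) (Z l)
  adjacent? (Z l) (Z l′) = ¬? (l Fin.≟ l′)

  adjacent-sym : ∀ {u v} → AdjG u v → AdjG v u
  adjacent-sym {X _} {X _} i≢i′ = i≢i′ ∘ sym
  adjacent-sym {X _} {Y _} xy   = xy
  adjacent-sym {Y _} {X _} xy   = xy
  adjacent-sym {Y _} {Y _} j≢j′ = j≢j′ ∘ sym
  adjacent-sym {Y _} {Z _} yz   = yz
  adjacent-sym {Z _} {Y _} yz   = yz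
  adjacent-sym {Z _} {Z _} l≢l′ = l≢l′ ∘ sym

  adjacent-irrefl : ∀ {v} → ¬ AdjG v v
  adjacent-irrefl {X _} i≢i = i≢i refl
  adjacent-irrefl {Y _} j≢j = j≢j refl
  adjacent-irrefl {Z _} l≢l = l≢l refl

  enumeration : Fin (n + (aTop + zSize)) ↔ VG
  enumeration = (↔-id (Fin n) ⊎-↔ +↔⊎) ↔-∘ +↔⊎

  linearCliqueWidth≤4 : LinCWAtMost 4 VG _≟VG_ AdjG
  linearCliqueWidth≤4 =
    LinearExpression.linCW-fromOrdering _≟VG_ adjacent? adjacent-sym adjacent-irrefl class targets
      (sortedBy enumeration key) (sortedBy-unique enumeration key) (sortedBy-complete enumeration key)
      (AllPairs.zipWith (λ (u≢w , k≤k) → compatible-byKey _ _ u≢w k≤k)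
        (sortedBy-unique enumeration key , sortedBy-sorted enumeration key))

-- Besides m ≥ 1, only the monotonicity of a and the consequence B ≥ 15 of 8m ≤ a₁ < B/2 are used.
lemma4 : (m B : ℕ) (a : ℕ → ℕ) →
    1 ≤ m → 1 ≤ B →
    (∀ i j → 1 ≤ i → i ≤ j → j ≤ 3 * m → a i ≤ a j) →
    (∀ i → 1 ≤ i → i ≤ 3 * m → 1 ≤ a i) →
    sumRange (3 * m) a ≡ m * B →
    (∀ i → 1 ≤ i → i ≤ 3 * m → (B < 4 * a i) × (2 * a i < B) × (8 * m ≤ a i)) →
    IsProperIntervalGraph (Construction.VG m B a) (Construction.AdjG m B a) ×
    LinCWAtMost 4 (Construction.VG m B a) (Construction._≟VG_ m B a) (Construction.AdjG m B a)
lemma4 m B a m≥1 _ a-mono _ _ bounds = isProperIntervalGraph , linearCliqueWidth≤4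
  where
  B≥15 : 15 ≤ B
  B≥15 with bounds 1 ≤-refl (≤-trans m≥1 (m≤m+n m _))
  ... | _ , 2a₁<B , 8m≤a₁ =
    ≤-trans (n≤1+n 15) (<⇒≤ (≤-<-trans (*-monoʳ-≤ 2 (≤-trans (*-monoʳ-≤ 8 m≥1) 8m≤a₁)) 2a₁<B))

  open ConstructedGraph m B a a-mono B≥15
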